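{- For every $n\ge1$, \[\sum_{\sigma\in B_n} q^{fexc(\sigma)}=\sum_{\sigma\in B_n} q^{fdes_F(\sigma)}.\]
   Context: $B_n$ is the group of bijections $\sigma$ of $[-n,n]\setminus\{0\}$ with $\sigma(-a)=-\sigma(a)$, written $\sigma=[\sigma(1),\dots,\sigma(n)]$. $\varepsilon(\sigma)=1$ if $\sigma(1)<0$ and $0$ otherwise. $exc_B(\sigma)=|\{1\le i\le n: i<|\sigma(i)|\}|$ and $fexc(\sigma)=2exc_B(\sigma)+\varepsilon(\sigma)$. $F$ is the friends order $-1<1<-2<2<\dots<-n<n$; $des_F(\sigma)=|\{1\le i\le n-1:\sigma(i)>_F\sigma(i+1)\}|$ and $fdes_F(\sigma)=2des_F(\sigma)+\varepsilon(\sigma)$. -}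

module Defs where

open import Data.Bool using (Bool; true; false; not; _∧_; if_then_else_)
open import Data.Nat using (ℕ; zero; suc; _+_; _*_; _<ᵇ_; _≡ᵇ_)
open import Data.Fin using (Fin; toℕ)
open import Data.Product using (_×_; _,_; proj₁; proj₂)
open import Data.List using (List; []; _∷_; concatMap; map)
open import Data.List.Base using (allFin)
open import Data.Vec using (Vec; []; _∷_)

-- A signed word of length n: entry i encodes σ(i+1) as (negative?, |σ(i+1)| - 1).
-- So (b , a) stands for the value  (if b then -(a+1) else a+1).
Entry : ℕ → Set
Entry n = Bool × Fin n

Word : ℕ → Set
Word n = Vec (Entry n) n

vecs : {A : Set} → List A → (m : ℕ) → List (Vec A m)
vecs xs zero    = [] ∷ []
vecs xs (suc m) = concatMap (λ x → map (x ∷_) (vecs xs m)) xs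

allEntries : (n : ℕ) → List (Entry n)
allEntries n = concatMap (λ b → map (b ,_) (allFin n)) (true ∷ false ∷ [])

elemFin : {n : ℕ} → Fin n → {m : ℕ} → Vec (Entry n) m → Bool
elemFin a []            = false
elemFin a ((_ , c) ∷ w) = if toℕ a ≡ᵇ toℕ c then true else elemFin a w

distinctAbs : {n m : ℕ} → Vec (Entry n) m → Bool
distinctAbs []            = true
distinctAbs ((_ , a) ∷ w) = not (elemFin a w) ∧ distinctAbs w

-- σ ∈ B_n  iff  i ↦ |σ(i)| is a bijection of [n] (injective suffices on a finite set);
-- signs are arbitrary and σ(-i) = -σ(i) is built into the encoding.
isSignedPerm : {n : ℕ} → Word n → Bool
isSignedPerm = distinctAbs

allWords : (n : ℕ) → List (Word n)
allWords n = vecs (allEntries n) n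

eps : {n m : ℕ} → Vec (Entry n) m → ℕ
eps []               = 0
eps ((true  , _) ∷ _) = 1
eps ((false , _) ∷ _) = 0

-- exc_B(σ) = #{1 ≤ i ≤ n : i < |σ(i)|}; position index i is 1-based, |σ(i)| = toℕ a + 1
excFrom : {n m : ℕ} → ℕ → Vec (Entry n) m → ℕ
excFrom i []            = 0
excFrom i ((_ , a) ∷ w) = (if i <ᵇ suc (toℕ a) then 1 else 0) + excFrom (suc i) w

excB : {n : ℕ} → Word n → ℕ
excB w = excFrom 1 w

fexc : {n : ℕ} → Word n → ℕ
fexc w = 2 * excB w + eps w

-- friends order -1 < 1 < -2 < 2 < … : rank of the value (b , a)
friendsRank : {n : ℕ} → Entry n → ℕ
friendsRank (b , a) = 2 * toℕ a + (if b then 0 else 1)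

_>F_ : {n : ℕ} → Entry n → Entry n → Bool
x >F y = friendsRank y <ᵇ friendsRank x

desFV : {n m : ℕ} → Vec (Entry n) m → ℕ
desFV []                = 0
desFV (x ∷ [])          = 0
desFV (x ∷ (y ∷ w))     = (if x >F y then 1 else 0) + desFV (y ∷ w)

desF : {n : ℕ} → Word n → ℕ
desF = desFV

fdesF : {n : ℕ} → Word n → ℕ
fdesF w = 2 * desF w + eps w

-- number of σ ∈ B_n with statistic value k, i.e. coefficient of q^k in Σ_{σ∈B_n} q^{stat σ}
countB : {A : Set} → (A → Bool) → List A → ℕ
countB p []       = 0
countB p (x ∷ xs) = (if p x then 1 else 0) + countB p xs

coeff : (n : ℕ) → (Word n → ℕ) → ℕ → ℕ
coeff n stat k = countB (λ w → isSignedPerm w ∧ (stat w ≡ᵇ k)) (allWords n)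

-- Both statistics have the form 2·s(|σ|) + ε(σ), where |σ| is the permutation of absolute values:
-- s = exc for fexc, and s = des for fdes_F, because the friends rank of ±a is 2a or 2a + 1, so
-- entries with distinct absolute values compare in the friends order as their absolute values do.
-- The signs of σ(2), …, σ(n) are unconstrained, hence each coefficient is 2^(n−1) times a count
-- over S_n, and it remains to see that exc and des are equidistributed on S_n. Both obey the
-- Eulerian recursion: the n + 1 ways of inserting a new maximum into a permutation with statistic
-- d give d exactly d + 1 times and d + 1 otherwise (plain insertion into the word for des,
-- insertion into the cycle structure for exc), and every permutation of [0, n] arises from
-- exactly one such insertion.
module Submission where

open import Defs

open import Relation.Binary.PropositionalEquality
  using (_≡_; _≢_; refl; sym; trans; cong; cong₂; subst; setoid; module ≡-Reasoning)
open import Data.Bool using (Bool; true; false; if_then_else_; not; _∧_)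
open import Data.Empty using (⊥-elim)
open import Data.Fin using (Fin; toℕ)
import Data.Fin as Fin
open import Data.List
  using (List; []; _∷_; _++_; _∷ʳ_; [_]; initLast; _∷ʳ′_; map; concatMap; length; replicate; filter;
         cartesianProductWith; cartesianProduct; allFin; tabulate; applyUpTo; upTo; downFrom)
import Data.List.Properties as L
open import Data.List.Properties
  using (map-++; map-∘; map-cong; map-tabulate; map-applyUpTo; map-replicate; ++-identityʳ;
         length-downFrom; length-++-≤ˡ; concatMap-cong; concatMap-map)
open import Data.List.Membership.Propositional using (_∈_; _∉_)
open import Data.List.Membership.Propositional.Properties
  using (∈-∃++; ∈-map⁺; ∈-map⁻; ∈-filter⁺; ∈-filter⁻; ∈-cartesianProductWith⁺; ∈-cartesianProductWith⁻;
         ∈-cartesianProduct⁺; ∈-cartesianProduct⁻; ∈-upTo⁺; ∈-upTo⁻; ∈-downFrom⁺; ∈-downFrom⁻)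
open import Data.List.Membership.Propositional.Properties.WithK using (unique∧set⇒bag)
open import Data.List.Relation.Binary.BagAndSetEquality using (∼bag⇒↭)
open import Data.List.Relation.Binary.Permutation.Propositional as ↭
  using (_↭_; ↭-refl; ↭-sym; ↭-trans; ↭-prep; ↭-swap; ↭-reflexive; ↭⇒↭ₛ; module PermutationReasoning)
open import Data.List.Relation.Binary.Permutation.Propositional.Properties
  using (map⁺; shift; shifts; ++⁺ˡ; ++⁺; drop-∷; ∷↭∷ʳ; ∈-resp-↭; ↭-length)
open import Data.List.Relation.Binary.Subset.Propositional using (_⊆_)
open import Data.List.Relation.Unary.All using (All; []; _∷_)
import Data.List.Relation.Unary.All as All
open import Data.List.Relation.Unary.All.Properties using (¬Any⇒All¬; All¬⇒¬Any) renaming (map⁺ to All-map⁺)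
open import Data.List.Relation.Unary.AllPairs using ([]; _∷_)
open import Data.List.Relation.Unary.Any using (here; there; tail; any?)
open import Data.List.Relation.Unary.Unique.Propositional using (Unique)
open import Data.List.Relation.Unary.Unique.Propositional.Properties
  using (cartesianProductWith⁺; cartesianProduct⁺; filter⁺; upTo⁺; downFrom⁺)
open import Data.Nat using (ℕ; zero; suc; _+_; _*_; _∸_; _^_; _≤_; _<_; z≤n; s≤s; z<s; _<ᵇ_; _≡ᵇ_)
open import Data.Nat.Properties
open import Data.Nat.ListAction using (sum)
open import Data.Nat.ListAction.Properties using (sum-++; sum-↭)
open import Data.Product using (_×_; _,_; proj₁; proj₂; ∃₂)
open import Data.Vec using (Vec; toList)
import Data.Vec as V
open import Function using (_∘_; id)
open import Function.Bundles using (mk⇔)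
open import Level using (0ℓ)
open import Relation.Binary.Definitions using (DecidableEquality; tri<; tri≈; tri>)
open import Relation.Nullary using (does; proof; yes; no)
open import Relation.Nullary.Reflects using (Reflects; ofʸ; ofⁿ; det; fromEquivalence)
open import Relation.Unary using (Pred; Decidable)
open import Data.List.Relation.Binary.Permutation.Setoid.Properties (setoid ℕ) using (Unique-resp-↭)
open import Data.List.Relation.Unary.Unique.DecPropositional _≟_ using (unique?)

indicator : Bool → ℕ
indicator b = if b then 1 else 0

private variable
  A B C : Set

indicator≤1 : ∀ b → indicator b ≤ 1
indicator≤1 true  = ≤-refl
indicator≤1 false = z≤n

<⇒<ᵇ≡true : ∀ {m n} → m < n → (m <ᵇ n) ≡ true
<⇒<ᵇ≡true {m} {n} m<n = det (<ᵇ-reflects-< m n) (ofʸ m<n)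

≤⇒>ᵇ≡false : ∀ {m n} → n ≤ m → (m <ᵇ n) ≡ false
≤⇒>ᵇ≡false {m} {n} n≤m = det (<ᵇ-reflects-< m n) (ofⁿ (≤⇒≯ n≤m))

countB-++ : ∀ (p : A → Bool) xs ys → countB p (xs ++ ys) ≡ countB p xs + countB p ys
countB-++ p []       ys = refl
countB-++ p (x ∷ xs) ys =
  trans (cong (indicator (p x) +_) (countB-++ p xs ys)) (sym (+-assoc (indicator (p x)) _ _))

countB-cong : ∀ {p q : A → Bool} → (∀ x → p x ≡ q x) → ∀ xs → countB p xs ≡ countB q xs
countB-cong p≗q []       = refl
countB-cong p≗q (x ∷ xs) = cong₂ _+_ (cong indicator (p≗q x)) (countB-cong p≗q xs)

countB-map : ∀ (p : B → Bool) (f : A → B) xs → countB p (map f xs) ≡ countB (p ∘ f) xs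
countB-map p f []       = refl
countB-map p f (x ∷ xs) = cong (indicator (p (f x)) +_) (countB-map p f xs)

countB-sum : ∀ (p : A → Bool) xs → countB p xs ≡ sum (map (indicator ∘ p) xs)
countB-sum p []       = refl
countB-sum p (x ∷ xs) = cong (indicator (p x) +_) (countB-sum p xs)

countB-↭ : ∀ (p : A → Bool) {xs ys} → xs ↭ ys → countB p xs ≡ countB p ys
countB-↭ p {xs} {ys} xs↭ys =
  trans (countB-sum p xs) (trans (sum-↭ (map⁺ (indicator ∘ p) xs↭ys)) (sym (countB-sum p ys)))

countB-concatMap : ∀ (p : B → Bool) (f : A → List B) xs →
                   countB p (concatMap f xs) ≡ sum (map (countB p ∘ f) xs)
countB-concatMap p f []       = refl
countB-concatMap p f (x ∷ xs) =
  trans (countB-++ p (f x) (concatMap f xs)) (cong (countB p (f x) +_) (countB-concatMap p f xs))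

countB-cartesianProductWith : ∀ (p : C → Bool) (f : A → B → C) xs ys →
  countB p (cartesianProductWith f xs ys) ≡ sum (map (λ x → countB (p ∘ f x) ys) xs)
countB-cartesianProductWith p f []       ys = refl
countB-cartesianProductWith p f (x ∷ xs) ys =
  trans (countB-++ p (map (f x) ys) _)
        (cong₂ _+_ (countB-map p (f x) ys) (countB-cartesianProductWith p f xs ys))

countB-filter : ∀ {P : Pred A 0ℓ} (P? : Decidable P) (s : A → B) (g : B → Bool) xs →
                countB (λ x → does (P? x) ∧ g (s x)) xs ≡ countB g (map s (filter P? xs))
countB-filter P? s g [] = refl
countB-filter P? s g (x ∷ xs) with does (P? x)
... | true  = cong (indicator (g (s x)) +_) (countB-filter P? s g xs)
... | false = countB-filter P? s g xs

sum-map-*ˡ : ∀ k (f : A → ℕ) xs → sum (map (λ x → k * f x) xs) ≡ k * sum (map f xs)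
sum-map-*ˡ k f []       = sym (*-zeroʳ k)
sum-map-*ˡ k f (x ∷ xs) =
  trans (cong (k * f x +_) (sum-map-*ˡ k f xs)) (sym (*-distribˡ-+ k (f x) _))

Unique-map⁺-injectiveOn : ∀ (f : A → B) {xs} →
  (∀ {x y} → x ∈ xs → y ∈ xs → f x ≡ f y → x ≡ y) → Unique xs → Unique (map f xs)
Unique-map⁺-injectiveOn f {[]}     _   []           = []
Unique-map⁺-injectiveOn f {x ∷ xs} inj (x∉xs ∷ uxs) =
  All-map⁺ (All.tabulate (λ y∈xs fx≡fy → All.lookup x∉xs y∈xs (inj (here refl) (there y∈xs) fx≡fy)))
  ∷ Unique-map⁺-injectiveOn f (λ x∈ y∈ → inj (there x∈) (there y∈)) uxs

map-cartesianProduct : ∀ (f : A × B → C) xs ys →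
  map f (cartesianProduct xs ys) ≡ concatMap (λ x → map (λ y → f (x , y)) ys) xs
map-cartesianProduct f []       ys = refl
map-cartesianProduct f (x ∷ xs) ys =
  trans (map-++ f (map (x ,_) ys) _) (cong₂ _++_ (sym (map-∘ ys)) (map-cartesianProduct f xs ys))

concatMap-↭ : ∀ (f : A → List B) {xs ys} → xs ↭ ys → concatMap f xs ↭ concatMap f ys
concatMap-↭ f ↭.refl         = ↭-refl
concatMap-↭ f (↭.prep x p)   = ++⁺ˡ (f x) (concatMap-↭ f p)
concatMap-↭ f (↭.swap x y p) = ↭-trans (shifts (f x) (f y)) (++⁺ˡ (f y) (++⁺ˡ (f x) (concatMap-↭ f p)))
concatMap-↭ f (↭.trans p q)  = ↭-trans (concatMap-↭ f p) (concatMap-↭ f q)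

concatMap-cong-↭ : ∀ {f g : A → List B} xs → (∀ {x} → x ∈ xs → f x ↭ g x) → concatMap f xs ↭ concatMap g xs
concatMap-cong-↭ []       _   = ↭-refl
concatMap-cong-↭ (x ∷ xs) f↭g = ++⁺ (f↭g (here refl)) (concatMap-cong-↭ xs (f↭g ∘ there))

Unique-⊆⇒length≤ : ∀ {xs ys : List A} → Unique xs → xs ⊆ ys → length xs ≤ length ys
Unique-⊆⇒length≤ [] _ = z≤n
Unique-⊆⇒length≤ {xs = x ∷ xs} (x∉xs ∷ u) xs⊆ys
  with ys₁ , ys₂ , refl ← ∈-∃++ (xs⊆ys (here refl)) =
  ≤-trans (s≤s (Unique-⊆⇒length≤ u xs⊆ys₁++ys₂)) (≤-reflexive (sym (↭-length (shift x ys₁ ys₂))))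
  where
  xs⊆ys₁++ys₂ : xs ⊆ ys₁ ++ ys₂
  xs⊆ys₁++ys₂ y∈xs = tail (λ y≡x → All.lookup x∉xs y∈xs (sym y≡x))
                          (∈-resp-↭ (shift x ys₁ ys₂) (xs⊆ys (there y∈xs)))

Unique-⊆-length⇒↭ : DecidableEquality A → ∀ {xs ys : List A} →
                    Unique xs → Unique ys → xs ⊆ ys → length ys ≤ length xs → xs ↭ ys
Unique-⊆-length⇒↭ _≟_ {xs} {ys} uxs uys xs⊆ys ys≤xs =
  ∼bag⇒↭ (unique∧set⇒bag uxs uys (mk⇔ xs⊆ys ys⊆xs))
  where
  ys⊆xs : ys ⊆ xs
  ys⊆xs {y} y∈ys with any? (y ≟_) xs
  ... | yes y∈xs = y∈xs
  ... | no  y∉xs = ⊥-elim (<⇒≱ (Unique-⊆⇒length≤ (¬Any⇒All¬ xs y∉xs ∷ uxs) y∷xs⊆ys) ys≤xs)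
    where
    y∷xs⊆ys : y ∷ xs ⊆ ys
    y∷xs⊆ys (here refl)   = y∈ys
    y∷xs⊆ys (there z∈xs) = xs⊆ys z∈xs

-- Words over an alphabet, and forgetting signs

words : List A → ℕ → List (List A)
words xs zero    = [] ∷ []
words xs (suc m) = cartesianProductWith _∷_ xs (words xs m)

module _ (f : A → B) {xs : List A} {ys : List B} {c : ℕ}
         (fibres : ∀ (g : B → ℕ) → sum (map (g ∘ f) xs) ≡ c * sum (map g ys)) where

  countB-vecs-map : ∀ m (R : List B → Bool) →
                    countB (R ∘ toList ∘ V.map f) (vecs xs m) ≡ c ^ m * countB R (words ys m)
  countB-vecs-map zero    R = sym (+-identityʳ _)
  countB-vecs-map (suc m) R = begin
      countB (R ∘ toList ∘ V.map f) (vecs xs (suc m))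
    ≡⟨ countB-concatMap _ _ xs ⟩
      sum (map (λ x → countB (R ∘ toList ∘ V.map f) (map (x V.∷_) (vecs xs m))) xs)
    ≡⟨ cong sum (map-cong (λ x → trans (countB-map (R ∘ toList ∘ V.map f) (x V.∷_) (vecs xs m))
                                       (countB-vecs-map m (R ∘ (f x ∷_)))) xs) ⟩
      sum (map (λ x → c ^ m * G (f x)) xs)
    ≡⟨ sum-map-*ˡ (c ^ m) (G ∘ f) xs ⟩
      c ^ m * sum (map (G ∘ f) xs)
    ≡⟨ cong (c ^ m *_) (fibres G) ⟩
      c ^ m * (c * sum (map G ys))
    ≡⟨ *-assoc (c ^ m) c _ ⟨
      c ^ m * c * sum (map G ys)
    ≡⟨ cong (_* sum (map G ys)) (*-comm (c ^ m) c) ⟩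
      c ^ suc m * sum (map G ys)
    ≡⟨ cong (c ^ suc m *_) (countB-cartesianProductWith R _∷_ ys (words ys m)) ⟨
      c ^ suc m * countB R (words ys (suc m))
    ∎
    where
    open ≡-Reasoning
    G : B → ℕ
    G y = countB (R ∘ (y ∷_)) (words ys m)

words-unique : ∀ {xs : List A} m → Unique xs → Unique (words xs m)
words-unique zero    _   = [] ∷ []
words-unique (suc m) uxs = cartesianProductWith⁺ _∷_ L.∷-injective uxs (words-unique m uxs)

∈-words⁺ : ∀ {xs : List A} {v} m → length v ≡ m → All (_∈ xs) v → v ∈ words xs m
∈-words⁺ {v = []}    zero    refl []           = here refl
∈-words⁺ {v = _ ∷ _} (suc m) refl (a∈xs ∷ v⊆xs) = ∈-cartesianProductWith⁺ _∷_ a∈xs (∈-words⁺ m refl v⊆xs)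

∈-words⁻ : ∀ {xs : List A} {v} m → v ∈ words xs m → length v ≡ m × All (_∈ xs) v
∈-words⁻ zero (here refl) = refl , []
∈-words⁻ {xs = xs} (suc m) v∈ with a , w , a∈xs , w∈ , refl ← ∈-cartesianProductWith⁻ _∷_ xs _ v∈ =
  let (|w|≡m , w⊆xs) = ∈-words⁻ m w∈ in cong suc |w|≡m , a∈xs ∷ w⊆xs

map-toℕ-allFin : ∀ n → map toℕ (allFin n) ≡ upTo n
map-toℕ-allFin zero    = refl
map-toℕ-allFin (suc n) = cong (0 ∷_) (begin
    map toℕ (tabulate Fin.suc)
  ≡⟨ map-tabulate Fin.suc toℕ ⟩
    tabulate (suc ∘ toℕ)
  ≡⟨ map-tabulate toℕ suc ⟨
    map suc (tabulate toℕ)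
  ≡⟨ cong (map suc) (trans (sym (map-tabulate id toℕ)) (map-toℕ-allFin n)) ⟩
    map suc (upTo n)
  ≡⟨ map-applyUpTo id suc n ⟩
    applyUpTo suc n
  ∎)
  where open ≡-Reasoning

sum-map-toℕ-allFin : ∀ n (g : ℕ → ℕ) → sum (map (g ∘ toℕ) (allFin n)) ≡ sum (map g (upTo n))
sum-map-toℕ-allFin n g = cong sum (trans (map-∘ (allFin n)) (cong (map g) (map-toℕ-allFin n)))

sum-allEntries : ∀ n (g : Entry n → ℕ) →
  sum (map g (allEntries n)) ≡ sum (map (g ∘ (true ,_)) (allFin n)) + sum (map (g ∘ (false ,_)) (allFin n))
sum-allEntries n g = begin
    sum (map g (map (true ,_) (allFin n) ++ map (false ,_) (allFin n) ++ []))
  ≡⟨ cong sum (map-++ g (map (true ,_) (allFin n)) _) ⟩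
    sum (map g (map (true ,_) (allFin n)) ++ map g (map (false ,_) (allFin n) ++ []))
  ≡⟨ sum-++ (map g (map (true ,_) (allFin n))) _ ⟩
    sum (map g (map (true ,_) (allFin n))) + sum (map g (map (false ,_) (allFin n) ++ []))
  ≡⟨ cong₂ (λ u v → sum u + sum (map g v)) (sym (map-∘ (allFin n))) (++-identityʳ (map (false ,_) (allFin n))) ⟩
    sum (map (g ∘ (true ,_)) (allFin n)) + sum (map g (map (false ,_) (allFin n)))
  ≡⟨ cong (λ u → sum (map (g ∘ (true ,_)) (allFin n)) + sum u) (map-∘ (allFin n)) ⟨
    sum (map (g ∘ (true ,_)) (allFin n)) + sum (map (g ∘ (false ,_)) (allFin n))
  ∎
  where open ≡-Reasoning

absWord : ∀ {n m} → Vec (Entry n) m → List ℕ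
absWord = toList ∘ V.map (toℕ ∘ proj₂)

allEntries-fibres : ∀ n (g : ℕ → ℕ) → sum (map (g ∘ toℕ ∘ proj₂) (allEntries n)) ≡ 2 * sum (map g (upTo n))
allEntries-fibres n g = begin
    sum (map (g ∘ toℕ ∘ proj₂) (allEntries n))
  ≡⟨ sum-allEntries n (g ∘ toℕ ∘ proj₂) ⟩
    sum (map (g ∘ toℕ) (allFin n)) + sum (map (g ∘ toℕ) (allFin n))
  ≡⟨ cong₂ _+_ (sum-map-toℕ-allFin n g) (trans (sum-map-toℕ-allFin n g) (sym (+-identityʳ _))) ⟩
    2 * sum (map g (upTo n))
  ∎
  where open ≡-Reasoning

countB-absWord : ∀ n m (R : List ℕ → Bool) →
  countB (R ∘ absWord) (vecs (allEntries n) m) ≡ 2 ^ m * countB R (words (upTo n) m)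
countB-absWord n = countB-vecs-map (toℕ ∘ proj₂) (allEntries-fibres n)

countB-signedWords : ∀ n m (Q : ℕ → List ℕ → Bool) →
  countB (λ w → Q (eps w) (absWord w)) (vecs (allEntries n) (suc m))
    ≡ 2 ^ m * (countB (Q 1) (words (upTo n) (suc m)) + countB (Q 0) (words (upTo n) (suc m)))
countB-signedWords n m Q = begin
    countB (λ w → Q (eps w) (absWord w)) (vecs (allEntries n) (suc m))
  ≡⟨ countB-concatMap _ _ (allEntries n) ⟩
    sum (map (λ x → countB (λ w → Q (eps w) (absWord w)) (map (x V.∷_) tails)) (allEntries n))
  ≡⟨ sum-allEntries n _ ⟩
    sum (map (λ a → countB P (map ((true , a) V.∷_) tails)) (allFin n))
      + sum (map (λ a → countB P (map ((false , a) V.∷_) tails)) (allFin n))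
  ≡⟨ cong₂ _+_ (headSign 1 true (λ _ _ → refl)) (headSign 0 false (λ _ _ → refl)) ⟩
    2 ^ m * countB (Q 1) (words (upTo n) (suc m)) + 2 ^ m * countB (Q 0) (words (upTo n) (suc m))
  ≡⟨ *-distribˡ-+ (2 ^ m) _ _ ⟨
    2 ^ m * (countB (Q 1) (words (upTo n) (suc m)) + countB (Q 0) (words (upTo n) (suc m)))
  ∎
  where
  open ≡-Reasoning
  tails : List (Vec (Entry n) m)
  tails = vecs (allEntries n) m
  P : Vec (Entry n) (suc m) → Bool
  P w = Q (eps w) (absWord w)
  headSign : ∀ e b → (∀ a w → P ((b , a) V.∷ w) ≡ Q e (toℕ a ∷ absWord w)) →
    sum (map (λ a → countB P (map ((b , a) V.∷_) tails)) (allFin n)) ≡ 2 ^ m * countB (Q e) (words (upTo n) (suc m))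
  headSign e b P≡ = begin
      sum (map (λ a → countB P (map ((b , a) V.∷_) tails)) (allFin n))
    ≡⟨ cong sum (map-cong (λ a → trans (countB-map P ((b , a) V.∷_) tails)
                                 (trans (countB-cong (P≡ a) tails) (countB-absWord n m (Q e ∘ (toℕ a ∷_)))))
                          (allFin n)) ⟩
      sum (map (λ a → 2 ^ m * G (toℕ a)) (allFin n))
    ≡⟨ sum-map-*ˡ (2 ^ m) (G ∘ toℕ) (allFin n) ⟩
      2 ^ m * sum (map (G ∘ toℕ) (allFin n))
    ≡⟨ cong (2 ^ m *_) (sum-map-toℕ-allFin n G) ⟩
      2 ^ m * sum (map G (upTo n))
    ≡⟨ cong (2 ^ m *_) (countB-cartesianProductWith (Q e) _∷_ (upTo n) (words (upTo n) m)) ⟨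
      2 ^ m * countB (Q e) (words (upTo n) (suc m))
    ∎
    where
    G : ℕ → ℕ
    G y = countB (Q e ∘ (y ∷_)) (words (upTo n) m)

-- The unsigned statistics

-- Values are stored as |σ(i)| − 1 while positions are 1-based, hence the suc in the comparison.
exc : ℕ → List ℕ → ℕ
exc i []      = 0
exc i (a ∷ v) = indicator (i <ᵇ suc a) + exc (suc i) v

des : List ℕ → ℕ
des []          = 0
des (_ ∷ [])    = 0
des (x ∷ y ∷ v) = indicator (y <ᵇ x) + des (y ∷ v)

excFrom-absWord : ∀ {n m} i (w : Vec (Entry n) m) → excFrom i w ≡ exc i (absWord w)
excFrom-absWord i V.[]            = refl
excFrom-absWord i ((_ , a) V.∷ w) = cong (indicator (i <ᵇ suc (toℕ a)) +_) (excFrom-absWord (suc i) w)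

double+bit-< : ∀ {x y s t} → s ≤ 1 → y < x → 2 * y + s < 2 * x + t
double+bit-< {x} {y} {s} {t} s≤1 y<x = begin-strict
  2 * y + s   <⟨ +-monoʳ-< (2 * y) (s≤s s≤1) ⟩
  2 * y + 2   ≡⟨ +-comm (2 * y) 2 ⟩
  2 + 2 * y   ≡⟨ *-suc 2 y ⟨
  2 * suc y   ≤⟨ *-monoʳ-≤ 2 y<x ⟩
  2 * x       ≤⟨ m≤m+n (2 * x) t ⟩
  2 * x + t   ∎
  where open ≤-Reasoning

double+bit-<ᵇ : ∀ {x y s t} → x ≢ y → s ≤ 1 → t ≤ 1 → (2 * y + s <ᵇ 2 * x + t) ≡ (y <ᵇ x)
double+bit-<ᵇ {x} {y} {s} {t} x≢y s≤1 t≤1 =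
  det (fromEquivalence (cancel ∘ <ᵇ⇒< _ _) (<⇒<ᵇ ∘ double+bit-< s≤1)) (<ᵇ-reflects-< y x)
  where
  cancel : 2 * y + s < 2 * x + t → y < x
  cancel lt with <-cmp y x
  ... | tri< y<x _ _ = y<x
  ... | tri≈ _ y≡x _ = ⊥-elim (x≢y (sym y≡x))
  ... | tri> _ _ x<y = ⊥-elim (<-asym lt (double+bit-< t≤1 x<y))

friendsBit≤1 : ∀ b → (if b then 0 else 1) ≤ 1
friendsBit≤1 true  = z≤n
friendsBit≤1 false = s≤s z≤n

desFV-absWord : ∀ {n m} (w : Vec (Entry n) m) → Unique (absWord w) → desFV w ≡ des (absWord w)
desFV-absWord V.[]                              _                  = refl
desFV-absWord (_ V.∷ V.[])                      _                  = refl
desFV-absWord ((b , a) V.∷ (c , a′) V.∷ w) ((a≢a′ ∷ _) ∷ u) =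
  cong₂ _+_ (cong indicator (double+bit-<ᵇ a≢a′ (friendsBit≤1 c) (friendsBit≤1 b)))
            (desFV-absWord ((c , a′) V.∷ w) u)

∈-∷-reflects : ∀ {x y : A} {ys b c} → Reflects (x ≡ y) b → Reflects (x ∈ ys) c →
               Reflects (x ∈ y ∷ ys) (if b then true else c)
∈-∷-reflects (ofʸ x≡y) _          = ofʸ (here x≡y)
∈-∷-reflects (ofⁿ x≢y) (ofʸ x∈ys) = ofʸ (there x∈ys)
∈-∷-reflects (ofⁿ x≢y) (ofⁿ x∉ys) = ofⁿ λ { (here x≡y) → x≢y x≡y ; (there x∈ys) → x∉ys x∈ys }

Unique-∷-reflects : ∀ {x : A} {xs b c} → Reflects (x ∈ xs) b → Reflects (Unique xs) c →
                    Reflects (Unique (x ∷ xs)) (not b ∧ c)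
Unique-∷-reflects (ofʸ x∈xs) _        = ofⁿ λ { (x∉xs ∷ _) → All¬⇒¬Any x∉xs x∈xs }
Unique-∷-reflects (ofⁿ x∉xs) (ofʸ u)  = ofʸ (¬Any⇒All¬ _ x∉xs ∷ u)
Unique-∷-reflects (ofⁿ x∉xs) (ofⁿ ¬u) = ofⁿ λ { (_ ∷ u) → ¬u u }

elemFin-reflects : ∀ {n m} (a : Fin n) (w : Vec (Entry n) m) → Reflects (toℕ a ∈ absWord w) (elemFin a w)
elemFin-reflects a V.[]            = ofⁿ λ ()
-- does (m ≟ n) unfolds to m ≡ᵇ n, the test used by elemFin.
elemFin-reflects a ((_ , c) V.∷ w) = ∈-∷-reflects (proof (toℕ a ≟ toℕ c)) (elemFin-reflects a w)

distinctAbs-reflects : ∀ {n m} (w : Vec (Entry n) m) → Reflects (Unique (absWord w)) (distinctAbs w)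
distinctAbs-reflects V.[]            = ofʸ []
distinctAbs-reflects ((_ , a) V.∷ w) = Unique-∷-reflects (elemFin-reflects a w) (distinctAbs-reflects w)

isSignedPerm≡unique? : ∀ {n} (w : Word n) → isSignedPerm w ≡ does (unique? (absWord w))
isSignedPerm≡unique? w = det (distinctAbs-reflects w) (proof (unique? (absWord w)))

fexc-absWord : ∀ {n} (w : Word n) → fexc w ≡ 2 * exc 1 (absWord w) + eps w
fexc-absWord w = cong (λ e → 2 * e + eps w) (excFrom-absWord 1 w)

fdesF-absWord : ∀ {n} (w : Word n) → Unique (absWord w) → fdesF w ≡ 2 * des (absWord w) + eps w
fdesF-absWord w u = cong (λ d → 2 * d + eps w) (desFV-absWord w u)

-- Permutations and the Eulerian recursion

perms : ℕ → List (List ℕ)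
perms n = filter unique? (words (upTo n) n)

perms-unique : ∀ n → Unique (perms n)
perms-unique n = filter⁺ unique? (words-unique n (upTo⁺ n))

↭downFrom⇒length : ∀ {n v} → v ↭ downFrom n → length v ≡ n
↭downFrom⇒length {n} v↭ = trans (↭-length v↭) (length-downFrom n)

↭downFrom⇒All< : ∀ {n v} → v ↭ downFrom n → All (_< n) v
↭downFrom⇒All< v↭ = All.tabulate (∈-downFrom⁻ ∘ ∈-resp-↭ v↭)

∈-perms⁺ : ∀ {n v} → v ↭ downFrom n → v ∈ perms n
∈-perms⁺ {n} v↭ =
  ∈-filter⁺ unique? (∈-words⁺ n (↭downFrom⇒length v↭) (All.map ∈-upTo⁺ (↭downFrom⇒All< v↭)))
                    (Unique-resp-↭ (↭⇒↭ₛ (↭-sym v↭)) (downFrom⁺ n))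

∈-perms⁻ : ∀ {n v} → v ∈ perms n → v ↭ downFrom n
∈-perms⁻ {n} v∈ with v∈words , uv ← ∈-filter⁻ unique? v∈ with |v|≡n , v⊆upTo ← ∈-words⁻ n v∈words =
  Unique-⊆-length⇒↭ _≟_ uv (downFrom⁺ n) (λ x∈v → ∈-downFrom⁺ (∈-upTo⁻ (All.lookup v⊆upTo x∈v)))
                    (≤-reflexive (trans (length-downFrom n) (sym |v|≡n)))

insert : List A → ℕ → A → List A
insert v       zero    x = x ∷ v
insert []      (suc j) x = [ x ]
insert (a ∷ v) (suc j) x = a ∷ insert v j x

-- x takes position j and the entry it displaces moves to the end (x is appended when j = length v):
-- in cycle notation, x is inserted right after j. For a new maximum x and j < length v, position j
-- becomes an excedance, the new last position is not one, and all other positions are untouched.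
displace : List A → ℕ → A → List A
displace []      j       x = [ x ]
displace (a ∷ v) zero    x = x ∷ (v ∷ʳ a)
displace (a ∷ v) (suc j) x = a ∷ displace v j x

insert-↭ : ∀ (v : List A) j x → insert v j x ↭ x ∷ v
insert-↭ v       zero    x = ↭-refl
insert-↭ []      (suc j) x = ↭-refl
insert-↭ (a ∷ v) (suc j) x = ↭-trans (↭-prep a (insert-↭ v j x)) (↭-swap a x ↭-refl)

displace-↭ : ∀ (v : List A) j x → displace v j x ↭ x ∷ v
displace-↭ []      j       x = ↭-refl
displace-↭ (a ∷ v) zero    x = ↭-prep x (↭-sym (∷↭∷ʳ a v))
displace-↭ (a ∷ v) (suc j) x = ↭-trans (↭-prep a (displace-↭ v j x)) (↭-swap a x ↭-refl)

insert-++ : ∀ (u w : List A) x → insert (u ++ w) (length u) x ≡ u ++ x ∷ w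
insert-++ []      w x = refl
insert-++ (a ∷ u) w x = cong (a ∷_) (insert-++ u w x)

displace-∷ʳ : ∀ (u : List A) x → displace u (length u) x ≡ u ∷ʳ x
displace-∷ʳ []      x = refl
displace-∷ʳ (a ∷ u) x = cong (a ∷_) (displace-∷ʳ u x)

displace-++ : ∀ (u : List A) y w x → displace (u ++ y ∷ w) (length u) x ≡ u ++ x ∷ (w ∷ʳ y)
displace-++ []      y w x = refl
displace-++ (a ∷ u) y w x = cong (a ∷_) (displace-++ u y w x)

insert-surjective : ∀ {x : A} {v} → x ∈ v → ∃₂ λ w j → j ≤ length w × insert w j x ≡ v
insert-surjective {x = x} x∈v with u , w , refl ← ∈-∃++ x∈v =
  u ++ w , length u , length-++-≤ˡ u , insert-++ u w x

displace-surjective : ∀ {x : A} {v} → x ∈ v → ∃₂ λ w j → j ≤ length w × displace w j x ≡ v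
displace-surjective {x = x} x∈v with u , w , refl ← ∈-∃++ x∈v with initLast w
... | []       = u , length u , ≤-refl , displace-∷ʳ u x
... | w′ ∷ʳ′ y = u ++ y ∷ w′ , length u , length-++-≤ˡ u , displace-++ u y w′ x

insert-injective : ∀ {x : A} {v v′ j j′} → x ∉ v → x ∉ v′ → j ≤ length v → j′ ≤ length v′ →
                   insert v j x ≡ insert v′ j′ x → v ≡ v′ × j ≡ j′
insert-injective {j = zero} {j′ = zero} _ _ _ _ eq = L.∷-injectiveʳ eq , refl
insert-injective {v = []}  {j = suc _}  _ _ () _ _
insert-injective {v′ = []} {j′ = suc _} _ _ _ () _
insert-injective {v′ = _ ∷ _} {zero} {suc _} _ x∉v′ _ _ eq = ⊥-elim (x∉v′ (here (L.∷-injectiveˡ eq)))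
insert-injective {v = _ ∷ _} {j = suc _} {zero} x∉v _ _ _ eq = ⊥-elim (x∉v (here (sym (L.∷-injectiveˡ eq))))
insert-injective {v = _ ∷ _} {_ ∷ _} {suc _} {suc _} x∉v x∉v′ (s≤s j≤) (s≤s j′≤) eq
  with refl , eq′ ← L.∷-injective eq
  with refl , refl ← insert-injective (x∉v ∘ there) (x∉v′ ∘ there) j≤ j′≤ eq′ = refl , refl

displace-injective : ∀ {x : A} {v v′ j j′} → x ∉ v → x ∉ v′ → j ≤ length v → j′ ≤ length v′ →
                     displace v j x ≡ displace v′ j′ x → v ≡ v′ × j ≡ j′
displace-injective {v = []} {[]} _ _ z≤n z≤n _ = refl , refl
displace-injective {v = []} {_ ∷ []}    {j′ = zero} _ _ _ _ ()
displace-injective {v = []} {_ ∷ _ ∷ _} {j′ = zero} _ _ _ _ ()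
displace-injective {v = []} {_ ∷ _} {j′ = suc _} _ x∉v′ _ _ eq = ⊥-elim (x∉v′ (here (L.∷-injectiveˡ eq)))
displace-injective {v = _ ∷ []}    {[]} {zero} _ _ _ _ ()
displace-injective {v = _ ∷ _ ∷ _} {[]} {zero} _ _ _ _ ()
displace-injective {v = _ ∷ _} {[]} {suc _} x∉v _ _ _ eq = ⊥-elim (x∉v (here (sym (L.∷-injectiveˡ eq))))
displace-injective {v = _ ∷ v} {_ ∷ v′} {zero} {zero} _ _ _ _ eq
  with refl , refl ← L.∷ʳ-injective v v′ (L.∷-injectiveʳ eq) = refl , refl
displace-injective {v = _ ∷ _} {_ ∷ _} {zero} {suc _} _ x∉v′ _ _ eq = ⊥-elim (x∉v′ (here (L.∷-injectiveˡ eq)))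
displace-injective {v = _ ∷ _} {_ ∷ _} {suc _} {zero} x∉v _ _ _ eq = ⊥-elim (x∉v (here (sym (L.∷-injectiveˡ eq))))
displace-injective {v = _ ∷ _} {_ ∷ _} {suc _} {suc _} x∉v x∉v′ (s≤s j≤) (s≤s j′≤) eq
  with refl , eq′ ← L.∷-injective eq
  with refl , refl ← displace-injective (x∉v ∘ there) (x∉v′ ∘ there) j≤ j′≤ eq′ = refl , refl

-- The statistic values of the n + 1 insertions of a new maximum into a permutation of [0, n)
-- with statistic d: d + 1 of them keep d, the other n − d raise it to d + 1.
eulerianProfile : ℕ → ℕ → List ℕ
eulerianProfile n d = replicate (suc d) d ++ replicate (n ∸ d) (suc d)

∷-map-suc-eulerianProfile : ∀ n d → suc d ∷ map suc (eulerianProfile n d) ≡ eulerianProfile (suc n) (suc d)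
∷-map-suc-eulerianProfile n d = cong (suc d ∷_) (begin
    map suc (replicate (suc d) d ++ replicate (n ∸ d) (suc d))
  ≡⟨ map-++ suc (replicate (suc d) d) _ ⟩
    map suc (replicate (suc d) d) ++ map suc (replicate (n ∸ d) (suc d))
  ≡⟨ cong₂ _++_ (map-replicate suc (suc d) d) (map-replicate suc (n ∸ d) (suc d)) ⟩
    replicate (suc d) (suc d) ++ replicate (n ∸ d) (suc (suc d))
  ∎)
  where open ≡-Reasoning

∷-eulerianProfile : ∀ {n d} → d ≤ n → suc d ∷ eulerianProfile n d ↭ eulerianProfile (suc n) d
∷-eulerianProfile {n} {d} d≤n = ↭-trans
  (↭-sym (shift (suc d) (replicate (suc d) d) (replicate (n ∸ d) (suc d))))
  (↭-reflexive (cong (λ k → replicate (suc d) d ++ replicate k (suc d)) (sym (+-∸-assoc 1 d≤n))))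

eulerianProfile-cons : ∀ t {n d} (G : ℕ → ℕ) → d ≤ n → applyUpTo G (suc n) ↭ eulerianProfile n d →
  suc d ∷ applyUpTo (λ j → indicator t + G j) (suc n) ↭ eulerianProfile (suc n) (indicator t + d)
eulerianProfile-cons true  {n} {d} G _ G↭ = ↭-trans
  (↭-prep (suc d) (↭-trans (↭-reflexive (sym (map-applyUpTo G suc (suc n)))) (map⁺ suc G↭)))
  (↭-reflexive (∷-map-suc-eulerianProfile n d))
eulerianProfile-cons false G d≤n G↭ = ↭-trans (↭-prep _ G↭) (∷-eulerianProfile d≤n)

des-∷-≤ : ∀ a v → des (a ∷ v) ≤ length v
des-∷-≤ a []      = z≤n
des-∷-≤ a (b ∷ v) = +-mono-≤ (indicator≤1 (b <ᵇ a)) (des-∷-≤ b v)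

exc-≤ : ∀ i v → exc i v ≤ length v
exc-≤ i []      = z≤n
exc-≤ i (a ∷ v) = +-mono-≤ (indicator≤1 (i <ᵇ suc a)) (exc-≤ (suc i) v)

des-insert-after : ∀ {M} a v → All (_< M) (a ∷ v) →
  applyUpTo (λ j → des (a ∷ insert v j M)) (suc (length v)) ↭ eulerianProfile (length v) (des (a ∷ v))
des-insert-after {M} a [] (a<M ∷ []) rewrite ≤⇒>ᵇ≡false {M} {a} (<⇒≤ a<M) = ↭-refl
des-insert-after {M} a (b ∷ v) (a<M ∷ b<M ∷ v<M) rewrite ≤⇒>ᵇ≡false {M} {a} (<⇒≤ a<M) | <⇒<ᵇ≡true b<M =
  eulerianProfile-cons (b <ᵇ a) (λ j → des (b ∷ insert v j M)) (des-∷-≤ b v) (des-insert-after b v (b<M ∷ v<M))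

des-insert : ∀ {M} v → All (_< M) v →
  applyUpTo (λ j → des (insert v j M)) (suc (length v)) ↭ eulerianProfile (length v) (des v)
des-insert []      []                 = ↭-refl
des-insert (a ∷ v) (a<M ∷ v<M) rewrite <⇒<ᵇ≡true a<M =
  ↭-trans (↭-prep _ (des-insert-after a v (a<M ∷ v<M))) (∷-eulerianProfile (des-∷-≤ a v))

exc-∷ʳ : ∀ i v a → exc i (v ∷ʳ a) ≡ exc i v + indicator (i + length v <ᵇ suc a)
exc-∷ʳ i []      a = trans (+-identityʳ _) (cong (λ k → indicator (k <ᵇ suc a)) (sym (+-identityʳ i)))
exc-∷ʳ i (b ∷ v) a = begin
    indicator (i <ᵇ suc b) + exc (suc i) (v ∷ʳ a)
  ≡⟨ cong (indicator (i <ᵇ suc b) +_) (exc-∷ʳ (suc i) v a) ⟩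
    indicator (i <ᵇ suc b) + (exc (suc i) v + indicator (suc i + length v <ᵇ suc a))
  ≡⟨ +-assoc (indicator (i <ᵇ suc b)) _ _ ⟨
    exc i (b ∷ v) + indicator (suc i + length v <ᵇ suc a)
  ≡⟨ cong (λ k → exc i (b ∷ v) + indicator (k <ᵇ suc a)) (+-suc i (length v)) ⟨
    exc i (b ∷ v) + indicator (i + length (b ∷ v) <ᵇ suc a)
  ∎
  where open ≡-Reasoning

exc-displace-head : ∀ p {M} a v → M ≡ p + suc (length v) → a < M →
                    exc (suc p) (displace (a ∷ v) 0 M) ≡ suc (exc (suc (suc p)) v)
exc-displace-head p {M} a v M≡ a<M = begin
    indicator (p <ᵇ M) + exc (suc (suc p)) (v ∷ʳ a)
  ≡⟨ cong₂ _+_ (cong indicator (<⇒<ᵇ≡true p<M)) (exc-∷ʳ (suc (suc p)) v a) ⟩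
    1 + (exc (suc (suc p)) v + indicator (suc p + length v <ᵇ a))
  ≡⟨ cong (λ b → suc (exc (suc (suc p)) v + indicator b)) (≤⇒>ᵇ≡false a≤) ⟩
    suc (exc (suc (suc p)) v + 0)
  ≡⟨ cong suc (+-identityʳ _) ⟩
    suc (exc (suc (suc p)) v)
  ∎
  where
  open ≡-Reasoning
  p<M : p < M
  p<M = subst (p <_) (sym M≡) (m<m+n p z<s)
  a≤ : a ≤ suc p + length v
  a≤ = m≤n⇒m≤1+n (≤-pred (subst (a <_) (trans M≡ (+-suc p (length v))) a<M))

exc-displace : ∀ p {M} v → M ≡ p + length v → All (_< M) v →
  applyUpTo (λ j → exc (suc p) (displace v j M)) (suc (length v)) ↭ eulerianProfile (length v) (exc (suc p) v)
exc-displace p {M} [] M≡ [] rewrite ≤⇒>ᵇ≡false {p} {M} (≤-reflexive (trans M≡ (+-identityʳ p))) = ↭-refl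
exc-displace p {M} (a ∷ v) M≡ (a<M ∷ v<M) = ↭-trans
  (↭-reflexive (cong (_∷ applyUpTo (λ j → exc (suc p) (a ∷ displace v j M)) (suc (length v)))
                     (exc-displace-head p a v M≡ a<M)))
  (eulerianProfile-cons (p <ᵇ a) (λ j → exc (suc (suc p)) (displace v j M)) (exc-≤ _ v)
                        (exc-displace (suc p) v (trans M≡ (+-suc p (length v))) v<M))

module InsertionRecursion
  (ins : List ℕ → ℕ → ℕ → List ℕ)
  (ins-↭ : ∀ v j x → ins v j x ↭ x ∷ v)
  (ins-surjective : ∀ {x v} → x ∈ v → ∃₂ λ w j → j ≤ length w × ins w j x ≡ v)
  (ins-injective : ∀ {x v v′ j j′} → x ∉ v → x ∉ v′ → j ≤ length v → j′ ≤ length v′ →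
                   ins v j x ≡ ins v′ j′ x → v ≡ v′ × j ≡ j′)
  (n : ℕ)
  where

  slots : List (List ℕ × ℕ)
  slots = cartesianProduct (perms n) (upTo (suc n))

  insertMax : List ℕ × ℕ → List ℕ
  insertMax (w , j) = ins w j n

  ∈-slots⁻ : ∀ {w j} → (w , j) ∈ slots → w ↭ downFrom n × n ∉ w × j ≤ length w
  ∈-slots⁻ {w} {j} wj∈ with w∈ , j∈ ← ∈-cartesianProduct⁻ (perms n) (upTo (suc n)) wj∈ =
    w↭ , (λ n∈w → <-irrefl refl (∈-downFrom⁻ (∈-resp-↭ w↭ n∈w))) ,
    subst (j ≤_) (sym (↭downFrom⇒length w↭)) (≤-pred (∈-upTo⁻ j∈))
    where
    w↭ : w ↭ downFrom n
    w↭ = ∈-perms⁻ w∈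

  insertMax-injectiveOn : ∀ {s t} → s ∈ slots → t ∈ slots → insertMax s ≡ insertMax t → s ≡ t
  insertMax-injectiveOn s∈ t∈ eq
    with _ , n∉w , j≤ ← ∈-slots⁻ s∈ | _ , n∉w′ , j′≤ ← ∈-slots⁻ t∈
    with refl , refl ← ins-injective n∉w n∉w′ j≤ j′≤ eq = refl

  perms-suc-↭ : perms (suc n) ↭ map insertMax slots
  perms-suc-↭ = ∼bag⇒↭ (unique∧set⇒bag (perms-unique (suc n))
    (Unique-map⁺-injectiveOn insertMax insertMax-injectiveOn (cartesianProduct⁺ (perms-unique n) (upTo⁺ (suc n))))
    (mk⇔ to from))
    where
    to : ∀ {v} → v ∈ perms (suc n) → v ∈ map insertMax slots
    to v∈ with w , j , j≤ , refl ← ins-surjective {x = n} (∈-resp-↭ (↭-sym (∈-perms⁻ v∈)) (here refl)) =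
      ∈-map⁺ insertMax (∈-cartesianProduct⁺ (∈-perms⁺ w↭) (∈-upTo⁺ (s≤s (subst (j ≤_) (↭downFrom⇒length w↭) j≤))))
      where
      w↭ : w ↭ downFrom n
      w↭ = drop-∷ (↭-trans (↭-sym (ins-↭ w j n)) (∈-perms⁻ v∈))
    from : ∀ {v} → v ∈ map insertMax slots → v ∈ perms (suc n)
    from v∈ with (w , j) , wj∈ , refl ← ∈-map⁻ insertMax v∈ =
      ∈-perms⁺ (↭-trans (ins-↭ w j n) (↭-prep n (proj₁ (∈-slots⁻ wj∈))))

  map-perms-suc : ∀ (stat : List ℕ → ℕ) →
    (∀ w → w ↭ downFrom n → applyUpTo (λ j → stat (ins w j n)) (suc n) ↭ eulerianProfile n (stat w)) →
    map stat (perms (suc n)) ↭ concatMap (eulerianProfile n) (map stat (perms n))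
  map-perms-suc stat profile = begin
      map stat (perms (suc n))
    ↭⟨ map⁺ stat perms-suc-↭ ⟩
      map stat (map insertMax slots)
    ≡⟨ map-∘ slots ⟨
      map (stat ∘ insertMax) slots
    ≡⟨ map-cartesianProduct (stat ∘ insertMax) (perms n) (upTo (suc n)) ⟩
      concatMap (λ w → map (λ j → stat (ins w j n)) (upTo (suc n))) (perms n)
    ≡⟨ concatMap-cong (λ w → map-applyUpTo id (λ j → stat (ins w j n)) (suc n)) (perms n) ⟩
      concatMap (λ w → applyUpTo (λ j → stat (ins w j n)) (suc n)) (perms n)
    ↭⟨ concatMap-cong-↭ (perms n) (λ w∈ → profile _ (∈-perms⁻ w∈)) ⟩
      concatMap (eulerianProfile n ∘ stat) (perms n)
    ≡⟨ concatMap-map (eulerianProfile n) stat (perms n) ⟨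
      concatMap (eulerianProfile n) (map stat (perms n))
    ∎
    where open PermutationReasoning

module InsertExc = InsertionRecursion displace displace-↭ displace-surjective displace-injective
module InsertDes = InsertionRecursion insert insert-↭ insert-surjective insert-injective

exc-displace-perm : ∀ n w → w ↭ downFrom n →
  applyUpTo (λ j → exc 1 (displace w j n)) (suc n) ↭ eulerianProfile n (exc 1 w)
exc-displace-perm n w w↭ with refl ← ↭downFrom⇒length w↭ = exc-displace 0 w refl (↭downFrom⇒All< w↭)

des-insert-perm : ∀ n w → w ↭ downFrom n →
  applyUpTo (λ j → des (insert w j n)) (suc n) ↭ eulerianProfile n (des w)
des-insert-perm n w w↭ with refl ← ↭downFrom⇒length w↭ = des-insert w (↭downFrom⇒All< w↭)

exc-des-↭ : ∀ n → map (exc 1) (perms n) ↭ map des (perms n)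
exc-des-↭ zero    = ↭-refl
exc-des-↭ (suc n) = begin
    map (exc 1) (perms (suc n))
  ↭⟨ InsertExc.map-perms-suc n (exc 1) (exc-displace-perm n) ⟩
    concatMap (eulerianProfile n) (map (exc 1) (perms n))
  ↭⟨ concatMap-↭ (eulerianProfile n) (exc-des-↭ n) ⟩
    concatMap (eulerianProfile n) (map des (perms n))
  ↭⟨ InsertDes.map-perms-suc n des (des-insert-perm n) ⟨
    map des (perms (suc n))
  ∎
  where open PermutationReasoning

-- The coefficients

-- The coefficient of q^k given the values M of the unsigned statistic on S_(m+1): the signs of
-- σ(2), …, σ(m+1) are free, and the sign of σ(1) is ε.
signedCount : ℕ → ℕ → List ℕ → ℕ
signedCount m k M = 2 ^ m * (withEps 1 + withEps 0)
  where
  withEps : ℕ → ℕ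
  withEps e = countB (λ d → 2 * d + e ≡ᵇ k) M

signedCount-↭ : ∀ m k {M M′} → M ↭ M′ → signedCount m k M ≡ signedCount m k M′
signedCount-↭ m k M↭M′ = cong (2 ^ m *_) (cong₂ _+_ (countB-↭ _ M↭M′) (countB-↭ _ M↭M′))

coeff≡signedCount : ∀ {m} k (stat : Word (suc m) → ℕ) (s : List ℕ → ℕ) →
  (∀ w → Unique (absWord w) → stat w ≡ 2 * s (absWord w) + eps w) →
  coeff (suc m) stat k ≡ signedCount m k (map s (perms (suc m)))
coeff≡signedCount {m} k stat s stat≡ = begin
    coeff (suc m) stat k
  ≡⟨ countB-cong unsign (allWords (suc m)) ⟩
    countB (λ w → Q (eps w) (absWord w)) (allWords (suc m))
  ≡⟨ countB-signedWords (suc m) m Q ⟩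
    2 ^ m * (countB (Q 1) W + countB (Q 0) W)
  ≡⟨ cong (2 ^ m *_) (cong₂ _+_ (countB-filter unique? s (λ d → 2 * d + 1 ≡ᵇ k) W)
                                (countB-filter unique? s (λ d → 2 * d + 0 ≡ᵇ k) W)) ⟩
    signedCount m k (map s (perms (suc m)))
  ∎
  where
  open ≡-Reasoning
  W : List (List ℕ)
  W = words (upTo (suc m)) (suc m)
  Q : ℕ → List ℕ → Bool
  Q e v = does (unique? v) ∧ (2 * s v + e ≡ᵇ k)
  unsign : ∀ w → (isSignedPerm w ∧ (stat w ≡ᵇ k)) ≡ Q (eps w) (absWord w)
  unsign w rewrite isSignedPerm≡unique? w with unique? (absWord w)
  ... | yes u = cong (_≡ᵇ k) (stat≡ w u)
  ... | no  _ = refl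

mainTheorem17 : (n : ℕ) → 1 ≤ n → (k : ℕ) → coeff n fexc k ≡ coeff n fdesF k
mainTheorem17 (suc m) _ k = begin
    coeff (suc m) fexc k
  ≡⟨ coeff≡signedCount {m} k fexc (exc 1) (λ w _ → fexc-absWord w) ⟩
    signedCount m k (map (exc 1) (perms (suc m)))
  ≡⟨ signedCount-↭ m k (exc-des-↭ (suc m)) ⟩
    signedCount m k (map des (perms (suc m)))
  ≡⟨ coeff≡signedCount {m} k fdesF des fdesF-absWord ⟨
    coeff (suc m) fdesF k
  ∎
  where open ≡-Reasoning
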